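{- Let $G$ be the path graph on vertices $v_1,\ldots,v_n$ (in this order), let $k\geq 2$ and $n\geq k+2$, and let $L\subseteq V$ with $|L|=k$. If $L$ induces exactly one gap, then $L$ is an NL-landmark set for parameter $k$. Consequently $md_k^{NL}(G)=k$.
   Context: $d(x,y)$ denotes the graph distance. A vertex $\tau$ separates distinct vertices $u,v$ if $d(u,\tau)\neq d(v,\tau)$. A set $L\subseteq V$ is an NL-landmark set (non-landmarks model) for parameter $k$ if every pair of distinct vertices $u,v\in V\setminus L$ is separated by at least $k$ distinct vertices of $L$; $md_k^{NL}(G)$ is the minimum cardinality of such a set. Given $L$, a hole is a vertex of $V\setminus L$, and a gap is a maximal sequence of consecutive holes along the path (a gap may contain an end vertex). -}

module Defs where

open import Data.Nat using (ℕ; zero; suc; _+_; _≤_; ∣_-_∣)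
open import Data.Bool using (Bool; true; false; if_then_else_)
open import Data.Fin using (Fin; toℕ)
open import Data.Fin.Subset using (Subset; _∈_; _∉_; _⊆_; ∣_∣)
open import Data.Vec using (Vec; []; _∷_)
open import Data.Product using (Σ; _×_)
open import Relation.Binary.PropositionalEquality using (_≡_; _≢_)
open import Relation.Nullary using (¬_)

-- The path graph P_n on vertices v_1,…,v_n is represented with vertex set Fin n
-- (vertex v_{i+1} is the element i : Fin n).  Its graph distance is |i - j|.
pathDist : {n : ℕ} → Fin n → Fin n → ℕ
pathDist i j = ∣ toℕ i - toℕ j ∣

Separates : {n : ℕ} → Fin n → Fin n → Fin n → Set
Separates u v τ = pathDist u τ ≢ pathDist v τ

IsNLLandmark : (n k : ℕ) → Subset n → Set
IsNLLandmark n k L =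
  (u v : Fin n) → u ≢ v → u ∉ L → v ∉ L →
  Σ (Subset n) (λ S → S ⊆ L × k ≤ ∣ S ∣ × ((τ : Fin n) → τ ∈ S → Separates u v τ))

IsMdNL : (n k m : ℕ) → Set
IsMdNL n k m =
  Σ (Subset n) (λ L → IsNLLandmark n k L × ∣ L ∣ ≡ m)
  × ((L : Subset n) → IsNLLandmark n k L → m ≤ ∣ L ∣)

-- Number of gaps (maximal runs of consecutive holes, i.e. non-landmarks) along the path.
-- The Bool flag records whether the previous vertex was a hole.
gapCount′ : {m : ℕ} → Bool → Vec Bool m → ℕ
gapCount′ p [] = 0
gapCount′ p (true ∷ xs) = gapCount′ false xs
gapCount′ p (false ∷ xs) = (if p then 0 else 1) + gapCount′ true xs

gapCount : {n : ℕ} → Subset n → ℕ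
gapCount L = gapCount′ false L

module Submission where

-- On the path P_n the distance is |i - j|, so a vertex τ
-- fails to separate two distinct vertices u, v only if τ lies strictly between
-- them (on one side of both, |u - τ| = |v - τ| forces u = v).  If L has exactly
-- one gap, then no landmark lies strictly between two holes, since a pattern
-- hole–landmark–hole along the path already produces two gaps.  Hence every
-- landmark separates every pair of holes, and L itself (of size k) witnesses
-- the NL-landmark property.

open import Defs
open import Data.Nat using (ℕ; _+_; _≤_)
open import Data.Fin.Subset using (Subset; ∣_∣)
open import Data.Product using (_×_)
open import Relation.Binary.PropositionalEquality using (_≡_)

open import Data.Nat using (zero; suc; z≤n; s≤s; _<_; _∸_; _≤?_; ∣_-_∣)
open import Data.Nat.Properties
  using (≤-trans; ≤-reflexive; <⇒≤; m≤n+m; ≰⇒>; +-comm; ∸-cancelʳ-≡; ∸-cancelˡ-≡;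
         m≤n⇒∣n-m∣≡n∸m; m≤n⇒∣m-n∣≡n∸m)
open import Data.Fin using (Fin; toℕ; zero; suc)
open import Data.Fin.Properties using (<-cmp; toℕ-injective; suc-injective)
open import Data.Fin.Subset using (_∈_; _∉_; ⊥)
open import Data.Fin.Subset.Properties using (p⊆q⇒∣p∣≤∣q∣; ∣⊥∣≡0)
open import Data.Vec using (Vec; _∷_; here; there)
open import Data.Bool using (Bool; true; false)
open import Data.Product using (Σ; ∃; _,_)
open import Data.Empty using (⊥-elim) renaming (⊥ to Empty)
open import Relation.Nullary using (yes; no)
open import Relation.Binary using (tri<; tri≈; tri>)
open import Relation.Binary.PropositionalEquality using (_≢_; refl; sym; cong; subst; module ≡-Reasoning)

hole⇒gap : ∀ {m} (xs : Vec Bool m) {v : Fin m} → v ∉ xs → 1 ≤ gapCount′ false xs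
hole⇒gap (true  ∷ xs) {zero}  v∉ = ⊥-elim (v∉ here)
hole⇒gap (false ∷ xs)         v∉ = s≤s z≤n
hole⇒gap (true  ∷ xs) {suc v} v∉ = hole⇒gap xs (λ v∈ → v∉ (there v∈))

landmark-hole⇒gap : ∀ {m} (p : Bool) (xs : Vec Bool m) {t v : Fin m} →
  t ∈ xs → v ∉ xs → toℕ t < toℕ v → 1 ≤ gapCount′ p xs
landmark-hole⇒gap p (true ∷ xs) {zero} {suc v} _ v∉ _ = hole⇒gap xs (λ v∈ → v∉ (there v∈))
landmark-hole⇒gap p (true ∷ xs) {suc t} {suc v} (there t∈) v∉ (s≤s t<v) =
  landmark-hole⇒gap false xs t∈ (λ v∈ → v∉ (there v∈)) t<v
landmark-hole⇒gap p (false ∷ xs) {suc t} {suc v} (there t∈) v∉ (s≤s t<v) =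
  ≤-trans (landmark-hole⇒gap true xs t∈ (λ v∈ → v∉ (there v∈)) t<v) (m≤n+m _ _)

hole-landmark-hole⇒twoGaps : ∀ {m} (xs : Vec Bool m) {u t v : Fin m} →
  u ∉ xs → t ∈ xs → v ∉ xs → toℕ u < toℕ t → toℕ t < toℕ v → 2 ≤ gapCount xs
hole-landmark-hole⇒twoGaps (true ∷ xs) {zero} u∉ _ _ _ _ = ⊥-elim (u∉ here)
hole-landmark-hole⇒twoGaps (false ∷ xs) {zero} {suc t} {suc v} _ (there t∈) v∉ _ (s≤s t<v) =
  s≤s (landmark-hole⇒gap true xs t∈ (λ v∈ → v∉ (there v∈)) t<v)
hole-landmark-hole⇒twoGaps (true ∷ xs) {suc u} {suc t} {suc v} u∉ (there t∈) v∉ (s≤s u<t) (s≤s t<v) =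
  hole-landmark-hole⇒twoGaps xs (λ u∈ → u∉ (there u∈)) t∈ (λ v∈ → v∉ (there v∈)) u<t t<v
hole-landmark-hole⇒twoGaps (false ∷ xs) {suc u} {suc t} {suc v} _ (there t∈) v∉ _ (s≤s t<v) =
  s≤s (landmark-hole⇒gap true xs t∈ (λ v∈ → v∉ (there v∈)) t<v)

oneGap⇒noLandmarkBetweenHoles : ∀ {n} (L : Subset n) → gapCount L ≡ 1 →
  ∀ {u t v} → u ∉ L → t ∈ L → v ∉ L → toℕ u < toℕ t → toℕ t < toℕ v → Empty
oneGap⇒noLandmarkBetweenHoles L oneGap u∉ t∈ v∉ u<t t<v
  with subst (2 ≤_) oneGap (hole-landmark-hole⇒twoGaps L u∉ t∈ v∉ u<t t<v)
... | s≤s ()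

equidistantAbove : ∀ {a b t} → t < a → t < b → ∣ a - t ∣ ≡ ∣ b - t ∣ → a ≡ b
equidistantAbove {a} {b} {t} t<a t<b eq = ∸-cancelʳ-≡ (<⇒≤ t<a) (<⇒≤ t<b) (begin
  a ∸ t      ≡⟨ sym (m≤n⇒∣n-m∣≡n∸m (<⇒≤ t<a)) ⟩
  ∣ a - t ∣  ≡⟨ eq ⟩
  ∣ b - t ∣  ≡⟨ m≤n⇒∣n-m∣≡n∸m (<⇒≤ t<b) ⟩
  b ∸ t      ∎)
  where open ≡-Reasoning

equidistantBelow : ∀ {a b t} → a < t → b < t → ∣ a - t ∣ ≡ ∣ b - t ∣ → a ≡ b
equidistantBelow {a} {b} {t} a<t b<t eq = ∸-cancelˡ-≡ (<⇒≤ a<t) (<⇒≤ b<t) (begin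
  t ∸ a      ≡⟨ sym (m≤n⇒∣m-n∣≡n∸m (<⇒≤ a<t)) ⟩
  ∣ a - t ∣  ≡⟨ eq ⟩
  ∣ b - t ∣  ≡⟨ m≤n⇒∣m-n∣≡n∸m (<⇒≤ b<t) ⟩
  t ∸ b      ∎)
  where open ≡-Reasoning

oneGap⇒landmarkSeparates : ∀ {n} (L : Subset n) → gapCount L ≡ 1 →
  {u v : Fin n} → u ≢ v → u ∉ L → v ∉ L → (τ : Fin n) → τ ∈ L → Separates u v τ
oneGap⇒landmarkSeparates L oneGap {u} {v} u≢v u∉ v∉ τ τ∈ eq with <-cmp τ u | <-cmp τ v
... | tri≈ _ τ≡u _ | _            = u∉ (subst (_∈ L) τ≡u τ∈)
... | _            | tri≈ _ τ≡v _ = v∉ (subst (_∈ L) τ≡v τ∈)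
... | tri< τ<u _ _ | tri< τ<v _ _ = u≢v (toℕ-injective (equidistantAbove τ<u τ<v eq))
... | tri> _ _ u<τ | tri> _ _ v<τ = u≢v (toℕ-injective (equidistantBelow u<τ v<τ eq))
... | tri< τ<u _ _ | tri> _ _ v<τ = oneGap⇒noLandmarkBetweenHoles L oneGap v∉ τ∈ u∉ v<τ τ<u
... | tri> _ _ u<τ | tri< τ<v _ _ = oneGap⇒noLandmarkBetweenHoles L oneGap u∉ τ∈ v∉ u<τ τ<v

oneGap⇒NLLandmark : ∀ n k (L : Subset n) → ∣ L ∣ ≡ k → gapCount L ≡ 1 → IsNLLandmark n k L
oneGap⇒NLLandmark n k L ∣L∣≡k oneGap u v u≢v u∉ v∉ =
  L , (λ τ∈ → τ∈) , ≤-reflexive (sym ∣L∣≡k) , oneGap⇒landmarkSeparates L oneGap u≢v u∉ v∉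

initialSegment : ∀ n k → suc k ≤ n → Subset n
initialSegment n       zero    _             = ⊥
initialSegment (suc n) (suc k) (s≤s k<n) = true ∷ initialSegment n k k<n

initialSegment-size : ∀ n k (k<n : suc k ≤ n) → ∣ initialSegment n k k<n ∣ ≡ k
initialSegment-size n       zero    _         = ∣⊥∣≡0 n
initialSegment-size (suc n) (suc k) (s≤s k<n) = cong suc (initialSegment-size n k k<n)

gapCount-afterHole-⊥ : ∀ n → gapCount′ true (⊥ {n = n}) ≡ 0
gapCount-afterHole-⊥ zero    = refl
gapCount-afterHole-⊥ (suc n) = gapCount-afterHole-⊥ n

initialSegment-oneGap : ∀ n k (k<n : suc k ≤ n) → gapCount (initialSegment n k k<n) ≡ 1
initialSegment-oneGap (suc n) zero    _         = cong suc (gapCount-afterHole-⊥ n)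
initialSegment-oneGap (suc n) (suc k) (s≤s k<n) = initialSegment-oneGap n k k<n

oneHole : ∀ {n} (L : Subset n) → suc ∣ L ∣ ≤ n → ∃ λ x → x ∉ L
oneHole (false ∷ L) _          = zero , λ ()
oneHole (true  ∷ L) (s≤s room) with oneHole L room
... | x , x∉ = suc x , λ { (there x∈) → x∉ x∈ }

twoHoles : ∀ {n} (L : Subset n) → suc (suc ∣ L ∣) ≤ n →
  Σ (Fin n) λ u → Σ (Fin n) λ v → u ≢ v × u ∉ L × v ∉ L
twoHoles (true ∷ L) (s≤s room) with twoHoles L room
... | u , v , u≢v , u∉ , v∉ =
  suc u , suc v , (λ eq → u≢v (suc-injective eq)) ,
  (λ { (there u∈) → u∉ u∈ }) , (λ { (there v∈) → v∉ v∈ })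
twoHoles (false ∷ L) (s≤s room) with oneHole L room
... | x , x∉ = zero , suc x , (λ ()) , (λ ()) , (λ { (there x∈) → x∉ x∈ })

-- Every NL-landmark set for k has at least k elements, provided n ≥ k + 2:
-- otherwise two holes exist, and their k separating landmarks lie in L.
NLLandmark-size : ∀ n k → suc (suc k) ≤ n → (L : Subset n) → IsNLLandmark n k L → k ≤ ∣ L ∣
NLLandmark-size n k room L isNL with k ≤? ∣ L ∣
... | yes k≤∣L∣ = k≤∣L∣
... | no  k≰∣L∣ with twoHoles L (≤-trans (s≤s (<⇒≤ (s≤s (≰⇒> k≰∣L∣)))) room)
... | u , v , u≢v , u∉ , v∉ with isNL u v u≢v u∉ v∉
... | S , S⊆L , k≤∣S∣ , _ = ≤-trans k≤∣S∣ (p⊆q⇒∣p∣≤∣q∣ S⊆L)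

-- Exactly one gap makes a k-set NL-landmark; hence md_k^NL(P_n) = k for n ≥ k + 2.
-- (The argument does not need the hypothesis 2 ≤ k.)
mainTheorem3 : (n k : ℕ) → 2 ≤ k → k + 2 ≤ n →
    ((L : Subset n) → ∣ L ∣ ≡ k → gapCount L ≡ 1 → IsNLLandmark n k L)
    × IsMdNL n k k
mainTheorem3 n k _ k+2≤n =
  oneGap⇒NLLandmark n k ,
  ((L₀ , oneGap⇒NLLandmark n k L₀ (initialSegment-size n k k<n) (initialSegment-oneGap n k k<n) ,
         initialSegment-size n k k<n) ,
   NLLandmark-size n k room)
  where
  room : suc (suc k) ≤ n
  room = subst (_≤ n) (+-comm k 2) k+2≤n
  k<n : suc k ≤ n
  k<n = <⇒≤ room
  L₀ : Subset n
  L₀ = initialSegment n k k<n
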